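{- In the setting below, machine $1$ belongs to $R_c$.
   Context: Setting: machines $M=\{1,\dots,m\}$ with speeds $s_1\ge s_2\ge\dots\ge s_m>0$ (unrestricted related machines), jobs with processing requirements $p_j\in[0,1]$; job $j$ on machine $i$ takes time $p_j/s_i$. For a schedule, $J_i$ is the set of jobs on machine $i$ and $L_i=\sum_{j\in J_i}p_j/s_i$ its load; the makespan is $\max_iL_i$. $C^*$ is the optimal (minimum) makespan, assumed $>0$; an optimal schedule is one of makespan $C^*$. Fix a schedule $\sigma$ with makespan $C_{\max}(\sigma)$ that is a near list schedule: the jobs are indexed $1,\dots,n$ such that, with $J_{i,j}=J_i\cap\{1,\dots,j\}$, for all machines $i'\ne i$ and all jobs $j\in J_i$: $L_{i'}+p_j/s_{i'}\ge L_i-\sum_{\ell\in J_{i,j-1}}p_\ell/s_i$ (all of $J_i,L_i,J_{i,j}$ refer to $\sigma$). Let $c=\lfloor C_{\max}(\sigma)/C^*\rfloor-1$. For each integer $k$ let $H_k=\{i\in M: L_{i'}\ge kC^*\text{ for all }i'\le i\}$ (so $H_k=\{1,\dots,i_k\}$ is an initial segment, and $H_k=M$ for $k\le0$). Let $R_k=H_k\setminus H_{k+1}$ for $k\in\{0,\dots,c-1\}$ and $R_c=H_c$.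
   Formalization: The speeds $s_i$ and the processing requirements $p_j$ are rational. -}

module Defs where

open import Data.Nat using (ℕ; zero; suc)
open import Data.Fin using (Fin; zero; suc; _<?_) renaming (_≟_ to _≟ᶠ_; _≤_ to _≤ᶠ_)
open import Data.Integer using (ℤ; +_) renaming (_-_ to _-ℤ_; _+_ to _+ℤ_; _≤_ to _≤ℤ_; _<_ to _<ℤ_)
open import Data.Rational using (ℚ; 0ℚ; _+_; _-_; _*_; _÷_; _⊔_; _≤_; Positive; floor; _/_)
open import Data.Rational.Properties using (pos⇒nonZero)
open import Data.Bool using (Bool; true; false; if_then_else_; _∧_)
open import Data.Product using (Σ; _×_)
open import Data.Sum using (_⊎_)
open import Relation.Nullary using (¬_; does)
open import Relation.Binary.PropositionalEquality using (_≡_; _≢_)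

sumFin : (n : ℕ) → (Fin n → ℚ) → ℚ
sumFin zero    f = 0ℚ
sumFin (suc n) f = f zero + sumFin n (λ j → f (suc j))

maxFin : (k : ℕ) → (Fin (suc k) → ℚ) → ℚ
maxFin zero    f = f zero
maxFin (suc k) f = f zero ⊔ maxFin k (λ i → f (suc i))

divPos : ℚ → (q : ℚ) → Positive q → ℚ
divPos a q q>0 = _÷_ a q {{pos⇒nonZero q {{q>0}}}}

toℚ : ℤ → ℚ
toℚ k = k / 1

-- Machines: Fin (suc m) (machine 1 of the paper = zero, machine i = Fin index i-1),
-- speeds s (positive), jobs: Fin n with processing requirements p.
-- A schedule is an assignment of jobs to machines.
module Sched (m n : ℕ) (s : Fin (suc m) → ℚ) (spos : (i : Fin (suc m)) → Positive (s i))
             (p : Fin n → ℚ) where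

  Schedule : Set
  Schedule = Fin n → Fin (suc m)

  L : Schedule → Fin (suc m) → ℚ
  L σ i = sumFin n (λ j → if does (σ j ≟ᶠ i) then divPos (p j) (s i) (spos i) else 0ℚ)

  Lbefore : Schedule → Fin (suc m) → Fin n → ℚ
  Lbefore σ i j = sumFin n (λ ℓ → if does (σ ℓ ≟ᶠ i) ∧ does (ℓ <? j)
                                     then divPos (p ℓ) (s i) (spos i) else 0ℚ)

  makespan : Schedule → ℚ
  makespan σ = maxFin m (L σ)

  IsOptMakespan : ℚ → Set
  IsOptMakespan C = Σ Schedule (λ τ → makespan τ ≡ C) × ((τ : Schedule) → C ≤ makespan τ)

  -- near list schedule w.r.t. the indexing of the jobs by Fin n
  NearList : Schedule → Set
  NearList σ = (i i' : Fin (suc m)) (j : Fin n) → i' ≢ i → σ j ≡ i →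
               L σ i - Lbefore σ i j ≤ L σ i' + divPos (p j) (s i') (spos i')

  module WithOpt (σ : Schedule) (Cstar : ℚ) (Cpos : Positive Cstar) where

    c : ℤ
    c = floor (divPos (makespan σ) Cstar Cpos) -ℤ (+ 1)

    H : ℤ → Fin (suc m) → Set
    H k i = (i' : Fin (suc m)) → i' ≤ᶠ i → toℚ k * Cstar ≤ L σ i'

    R : ℤ → Fin (suc m) → Set
    R k i = (k ≡ c × H k i)
          ⊎ ((+ 0 ≤ℤ k) × (k <ℤ c) × H k i × ¬ H (k +ℤ + 1) i)

{-# OPTIONS --safe #-}
-- An optimal schedule puts every job j on some machine no faster than machine 1, so
-- p_j / s_1 ≤ C*.  On any other machine i the first job j has nothing before it, so the
-- near-list inequality against machine 1 gives L_i ≤ L_1 + p_j / s_1 ≤ L_1 + C*.  Hence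
-- C_max ≤ L_1 + C*, and c C* = (⌊C_max / C*⌋ − 1) C* ≤ C_max − C* ≤ L_1, i.e. machine 1
-- lies in H_c = R_c.
module Submission where

open import Defs
open import Data.Nat using (ℕ; zero; suc; s≤s; z≤n)
open import Data.Fin using (Fin; zero; suc; _<?_) renaming (_≟_ to _≟ᶠ_; _≤_ to _≤ᶠ_; _<_ to _<ᶠ_)
open import Data.Integer as ℤ using (ℤ; +_)
import Data.Integer.Properties as ℤP
open import Data.Integer.DivMod using ([n/d]*d≤n)
open import Data.Integer.Solver using (module +-*-Solver)
open import Data.Rational using (ℚ; 0ℚ; 1ℚ; _≤_; Positive; NonZero; nonNegative; _+_; _-_; -_; _*_; 1/_; floor; ↥_; ↧_; toℚᵘ)
open import Data.Rational.Properties hiding (_<?_)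
open import Data.Rational.Unnormalised as ℚᵘ using (*≡*; *≤*)
import Data.Rational.Unnormalised.Properties as ℚᵘ
import Algebra.Properties.AbelianGroup as AbelianGroupProperties
open import Data.Product using (_×_; ∃; _,_; proj₁)
open import Data.Sum using (_⊎_; inj₁; inj₂)
open import Data.Empty using (⊥-elim)
open import Data.Bool using (if_then_else_; _∧_)
open import Relation.Nullary using (¬_; yes; no; does)
open import Relation.Nullary.Decidable using (dec-false)
open import Relation.Unary using (Pred; Decidable)
open import Relation.Binary.PropositionalEquality using (_≡_; _≢_; refl; sym; cong; cong₂)

sumFin-nonNeg : ∀ n (f : Fin n → ℚ) → (∀ j → 0ℚ ≤ f j) → 0ℚ ≤ sumFin n f
sumFin-nonNeg zero    f f≥0 = ≤-refl
sumFin-nonNeg (suc n) f f≥0 =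
  +-mono-≤ (f≥0 zero) (sumFin-nonNeg n (λ j → f (suc j)) (λ j → f≥0 (suc j)))

term≤sumFin : ∀ n (f : Fin n → ℚ) → (∀ j → 0ℚ ≤ f j) → ∀ k → f k ≤ sumFin n f
term≤sumFin (suc n) f f≥0 zero =
  ≤-trans (≤-reflexive (sym (+-identityʳ (f zero))))
          (+-monoʳ-≤ (f zero) (sumFin-nonNeg n (λ j → f (suc j)) (λ j → f≥0 (suc j))))
term≤sumFin (suc n) f f≥0 (suc k) =
  ≤-trans (≤-reflexive (sym (+-identityˡ (f (suc k)))))
          (+-mono-≤ (f≥0 zero) (term≤sumFin n (λ j → f (suc j)) (λ j → f≥0 (suc j)) k))

sumFin-zero : ∀ n (f : Fin n → ℚ) → (∀ j → f j ≡ 0ℚ) → sumFin n f ≡ 0ℚ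
sumFin-zero zero    f f≡0 = refl
sumFin-zero (suc n) f f≡0 = cong₂ _+_ (f≡0 zero) (sumFin-zero n (λ j → f (suc j)) (λ j → f≡0 (suc j)))

maxFin-lub : ∀ k (f : Fin (suc k) → ℚ) {b} → (∀ i → f i ≤ b) → maxFin k f ≤ b
maxFin-lub zero    f f≤b = f≤b zero
maxFin-lub (suc k) f f≤b = ⊔-lub (f≤b zero) (maxFin-lub k (λ i → f (suc i)) (λ i → f≤b (suc i)))

term≤maxFin : ∀ k (f : Fin (suc k) → ℚ) i → f i ≤ maxFin k f
term≤maxFin zero    f zero    = ≤-refl
term≤maxFin (suc k) f zero    = p≤p⊔q (f zero) _
term≤maxFin (suc k) f (suc i) = p≤q⇒p≤r⊔q (f zero) (term≤maxFin k (λ i → f (suc i)) i)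

least-witness : ∀ n {ℓ} (P : Pred (Fin n) ℓ) → Decidable P →
                (∀ j → ¬ P j) ⊎ ∃ λ j → P j × (∀ l → l <ᶠ j → ¬ P l)
least-witness zero    P P? = inj₁ λ ()
least-witness (suc n) P P? with P? zero | least-witness n (λ j → P (suc j)) (λ j → P? (suc j))
... | yes P0 | _                    = inj₂ (zero , P0 , λ _ ())
... | no ¬P0 | inj₁ ¬P              = inj₁ λ { zero → ¬P0 ; (suc j) → ¬P j }
... | no ¬P0 | inj₂ (j , Pj , less) = inj₂ (suc j , Pj , λ { zero _ → ¬P0 ; (suc l) (s≤s l<j) → less l l<j })

module ℚ+ = AbelianGroupProperties +-0-abelianGroup
module ℤ+ = AbelianGroupProperties ℤP.+-0-abelianGroup

+-cancelʳ-≤ : ∀ {p q} r → p + r ≤ q + r → p ≤ q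
+-cancelʳ-≤ {p} {q} r p+r≤q+r = begin
  p          ≡⟨ ℚ+.//-rightDividesʳ r p ⟨
  p + r - r  ≤⟨ +-monoˡ-≤ (- r) p+r≤q+r ⟩
  q + r - r  ≡⟨ ℚ+.//-rightDividesʳ r q ⟩
  q          ∎
  where open ≤-Reasoning

module _ (q : ℚ) (q>0 : Positive q) where
  private instance
    q≢0 : NonZero q
    q≢0 = pos⇒nonZero q {{q>0}}

  divPos-*-cancel : ∀ a → divPos a q q>0 * q ≡ a
  divPos-*-cancel a = begin-equality
    a * 1/ q * q    ≡⟨ *-assoc a (1/ q) q ⟩
    a * (1/ q * q)  ≡⟨ cong (a *_) (*-inverseˡ q) ⟩
    a * 1ℚ          ≡⟨ *-identityʳ a ⟩
    a               ∎
    where open ≤-Reasoning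

  divPos-nonNeg : ∀ {a} → 0ℚ ≤ a → 0ℚ ≤ divPos a q q>0
  divPos-nonNeg {a} a≥0 = *-cancelʳ-≤-pos q {{q>0}} (begin
    0ℚ * q              ≡⟨ *-zeroˡ q ⟩
    0ℚ                  ≤⟨ a≥0 ⟩
    a                   ≡⟨ divPos-*-cancel a ⟨
    divPos a q q>0 * q  ∎)
    where open ≤-Reasoning

divPos-antimono-≤ : ∀ {a q₁ q₂} (q₁>0 : Positive q₁) (q₂>0 : Positive q₂) → 0ℚ ≤ a → q₁ ≤ q₂ →
                    divPos a q₂ q₂>0 ≤ divPos a q₁ q₁>0
divPos-antimono-≤ {a} {q₁} {q₂} q₁>0 q₂>0 a≥0 q₁≤q₂ = *-cancelʳ-≤-pos q₁ {{q₁>0}} (begin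
  divPos a q₂ q₂>0 * q₁  ≤⟨ *-monoˡ-≤-nonNeg (divPos a q₂ q₂>0) {{nonNegative (divPos-nonNeg q₂ q₂>0 a≥0)}} q₁≤q₂ ⟩
  divPos a q₂ q₂>0 * q₂  ≡⟨ divPos-*-cancel q₂ q₂>0 a ⟩
  a                      ≡⟨ divPos-*-cancel q₁ q₁>0 a ⟨
  divPos a q₁ q₁>0 * q₁  ∎)
  where open ≤-Reasoning

toℚ-≃ : ∀ k → toℚᵘ (toℚ k) ℚᵘ.≃ ℚᵘ.mkℚᵘ k 0
toℚ-≃ k = toℚᵘ-fromℚᵘ (ℚᵘ.mkℚᵘ k 0)

toℚ-homo-+ : ∀ a b → toℚ (a ℤ.+ b) ≡ toℚ a + toℚ b
toℚ-homo-+ a b = toℚᵘ-injective (begin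
  toℚᵘ (toℚ (a ℤ.+ b))                ≈⟨ toℚ-≃ (a ℤ.+ b) ⟩
  ℚᵘ.mkℚᵘ (a ℤ.+ b) 0                  ≈⟨ *≡* (solve 2 (λ a b → (a :+ b) :* con (+ 1) := (a :* con (+ 1) :+ b :* con (+ 1)) :* con (+ 1)) refl a b) ⟩
  ℚᵘ.mkℚᵘ a 0 ℚᵘ.+ ℚᵘ.mkℚᵘ b 0         ≈⟨ ℚᵘ.+-cong (toℚ-≃ a) (toℚ-≃ b) ⟨
  toℚᵘ (toℚ a) ℚᵘ.+ toℚᵘ (toℚ b)      ≈⟨ toℚᵘ-homo-+ (toℚ a) (toℚ b) ⟨
  toℚᵘ (toℚ a + toℚ b)                ∎)
  where open ℚᵘ.≃-Reasoning
        open +-*-Solver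

floor-≤ : ∀ x → toℚ (floor x) ≤ x
floor-≤ x@record{} = toℚᵘ-cancel-≤ (ℚᵘ.≤-respˡ-≃ (ℚᵘ.≃-sym (toℚ-≃ (floor x)))
  (*≤* (ℤP.≤-trans ([n/d]*d≤n (↥ x) (↧ x)) (ℤP.≤-reflexive (sym (ℤP.*-identityʳ (↥ x)))))))

[⌊a/q⌋-1]*q+q≤a : ∀ q (q>0 : Positive q) a → toℚ (floor (divPos a q q>0) ℤ.- + 1) * q + q ≤ a
[⌊a/q⌋-1]*q+q≤a q q>0 a = begin
  r * q + q                    ≡⟨ cong (λ t → r * q + t) (*-identityˡ q) ⟨
  r * q + 1ℚ * q               ≡⟨ *-distribʳ-+ q r 1ℚ ⟨
  (r + 1ℚ) * q                 ≡⟨⟩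
  (r + toℚ (+ 1)) * q          ≡⟨ cong (_* q) (toℚ-homo-+ (k ℤ.- + 1) (+ 1)) ⟨
  toℚ (k ℤ.- + 1 ℤ.+ + 1) * q  ≡⟨ cong (λ k′ → toℚ k′ * q) (ℤ+.//-rightDividesˡ (+ 1) k) ⟩
  toℚ k * q                    ≤⟨ *-monoʳ-≤-nonNeg q {{pos⇒nonNeg q {{q>0}}}} (floor-≤ (divPos a q q>0)) ⟩
  divPos a q q>0 * q           ≡⟨ divPos-*-cancel q q>0 a ⟩
  a                            ∎
  where
  open ≤-Reasoning
  k : ℤ
  k = floor (divPos a q q>0)
  r : ℚ
  r = toℚ (k ℤ.- + 1)

module Loads (m n : ℕ) (s : Fin (suc m) → ℚ) (spos : ∀ i → Positive (s i))
             (p : Fin n → ℚ) (p≥0 : ∀ j → 0ℚ ≤ p j) where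
  open Sched m n s spos p

  time : Fin (suc m) → Fin n → ℚ
  time i j = divPos (p j) (s i) (spos i)

  loadShare : Schedule → Fin (suc m) → Fin n → ℚ
  loadShare τ i j = if does (τ j ≟ᶠ i) then time i j else 0ℚ

  loadShare-nonNeg : ∀ τ i j → 0ℚ ≤ loadShare τ i j
  loadShare-nonNeg τ i j with τ j ≟ᶠ i
  ... | yes _ = divPos-nonNeg (s i) (spos i) (p≥0 j)
  ... | no  _ = ≤-refl

  L-nonNeg : ∀ τ i → 0ℚ ≤ L τ i
  L-nonNeg τ i = sumFin-nonNeg n (loadShare τ i) (loadShare-nonNeg τ i)

  time≤L : ∀ τ j → time (τ j) j ≤ L τ (τ j)
  time≤L τ j = ≤-trans (≤-reflexive (sym (own-share (τ j ≟ᶠ τ j))))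
                       (term≤sumFin n (loadShare τ (τ j)) (loadShare-nonNeg τ (τ j)) j)
    where
    own-share : ∀ d → (if does d then time (τ j) j else 0ℚ) ≡ time (τ j) j
    own-share (yes _) = refl
    own-share (no τj≢τj) = ⊥-elim (τj≢τj refl)

  L-idle : ∀ τ i → (∀ j → τ j ≢ i) → L τ i ≡ 0ℚ
  L-idle τ i idle = sumFin-zero n (loadShare τ i) share≡0
    where
    share≡0 : ∀ j → loadShare τ i j ≡ 0ℚ
    share≡0 j with τ j ≟ᶠ i
    ... | yes τj≡i = ⊥-elim (idle j τj≡i)
    ... | no  _    = refl

  Lbefore-first : ∀ τ i j → (∀ l → l <ᶠ j → τ l ≢ i) → Lbefore τ i j ≡ 0ℚ
  Lbefore-first τ i j first = sumFin-zero n _ share≡0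
    where
    share≡0 : ∀ l → (if does (τ l ≟ᶠ i) ∧ does (l <? j) then time i l else 0ℚ) ≡ 0ℚ
    share≡0 l with τ l ≟ᶠ i
    ... | yes τl≡i = cong (if_then time i l else 0ℚ) (dec-false (l <? j) (λ l<j → first l l<j τl≡i))
    ... | no  _    = refl

  time-fastest≤makespan : (∀ i → s i ≤ s zero) → ∀ τ j → time zero j ≤ makespan τ
  time-fastest≤makespan fastest τ j = begin
    time zero j         ≤⟨ divPos-antimono-≤ (spos (τ j)) (spos zero) (p≥0 j) (fastest (τ j)) ⟩
    time (τ j) j        ≤⟨ time≤L τ j ⟩
    L τ (τ j)           ≤⟨ term≤maxFin m (L τ) (τ j) ⟩
    makespan τ          ∎
    where open ≤-Reasoning

  module _ (σ : Schedule) (nearList : NearList σ) {b : ℚ} (b≥0 : 0ℚ ≤ b)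
           (time-fastest≤b : ∀ j → time zero j ≤ b) where

    L≤L₀+b : ∀ i → L σ i ≤ L σ zero + b
    L≤L₀+b zero = ≤-trans (≤-reflexive (sym (+-identityʳ (L σ zero)))) (+-monoʳ-≤ (L σ zero) b≥0)
    L≤L₀+b (suc i) with least-witness n (λ j → σ j ≡ suc i) (λ j → σ j ≟ᶠ suc i)
    ... | inj₁ idle = begin
      L σ (suc i)    ≡⟨ L-idle σ (suc i) idle ⟩
      0ℚ             ≤⟨ +-mono-≤ (L-nonNeg σ zero) b≥0 ⟩
      L σ zero + b   ∎
      where open ≤-Reasoning
    ... | inj₂ (j , σj≡i , first) = begin
      L σ (suc i)                        ≡⟨ +-identityʳ (L σ (suc i)) ⟨
      L σ (suc i) - 0ℚ                   ≡⟨ cong (λ t → L σ (suc i) - t) (Lbefore-first σ (suc i) j first) ⟨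
      L σ (suc i) - Lbefore σ (suc i) j  ≤⟨ nearList (suc i) zero j (λ ()) σj≡i ⟩
      L σ zero + time zero j             ≤⟨ +-monoʳ-≤ (L σ zero) (time-fastest≤b j) ⟩
      L σ zero + b                       ∎
      where open ≤-Reasoning

    makespan≤L₀+b : makespan σ ≤ L σ zero + b
    makespan≤L₀+b = maxFin-lub m (L σ) L≤L₀+b

lemma8 : (m n : ℕ) (s : Fin (suc m) → ℚ) (spos : (i : Fin (suc m)) → Positive (s i))
    → ((i i' : Fin (suc m)) → i ≤ᶠ i' → s i' ≤ s i)
    → (p : Fin n → ℚ) → ((j : Fin n) → (0ℚ ≤ p j) × (p j ≤ 1ℚ))
    → (Cstar : ℚ) → Sched.IsOptMakespan m n s spos p Cstar
    → (Cpos : Positive Cstar)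
    → (σ : Sched.Schedule m n s spos p) → Sched.NearList m n s spos p σ
    → Sched.WithOpt.R m n s spos p σ Cstar Cpos
    (Sched.WithOpt.c m n s spos p σ Cstar Cpos) zero
lemma8 m n s spos s-antitone p p-bounds Cstar ((τ , τ-opt) , _) Cpos σ nearList =
  inj₁ (refl , λ { zero _ → c*C*≤L₀ ; (suc _) () })
  where
  open Sched m n s spos p
  open WithOpt σ Cstar Cpos
  open Loads m n s spos p (λ j → proj₁ (p-bounds j))

  time-fastest≤C* : ∀ j → time zero j ≤ Cstar
  time-fastest≤C* j = ≤-trans (time-fastest≤makespan (λ i → s-antitone zero i z≤n) τ j) (≤-reflexive τ-opt)

  c*C*≤L₀ : toℚ c * Cstar ≤ L σ zero
  c*C*≤L₀ = +-cancelʳ-≤ Cstar (begin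
    toℚ c * Cstar + Cstar  ≤⟨ [⌊a/q⌋-1]*q+q≤a Cstar Cpos (makespan σ) ⟩
    makespan σ             ≤⟨ makespan≤L₀+b σ nearList (<⇒≤ (positive⁻¹ Cstar {{Cpos}})) time-fastest≤C* ⟩
    L σ zero + Cstar       ∎)
    where open ≤-Reasoning
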